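{- Let $\Gamma$ be a triangulation of a connected closed $2$-dimensional surface $M$ and let $\tau$ be a $z$-orientation of $\Gamma$. Then every face of $\Gamma$ satisfies exactly one of the following: (I) the face contains two edges of type I and its third edge is of type II; (II) all three edges of the face are of type II and, with the directions induced by $\tau$, they form a directed cycle.
   Context: Let $M$ be a connected closed $2$-dimensional surface (not necessarily orientable). A triangulation $\Gamma$ of $M$ is a $2$-cell embedding of a connected simple finite graph in $M$ all of whose faces are triangles; every edge lies in exactly two distinct faces and two distinct faces meet in an edge, a vertex, or not at all. A zigzag in $\Gamma$ is a sequence of edges $(e_i)_{i\in\mathbb N}$ such that for every $i$: $e_i$ and $e_{i+1}$ are distinct edges of some face; the faces containing $e_i,e_{i+1}$ and $e_{i+1},e_{i+2}$ are distinct; and $e_i$, $e_{i+2}$ have no common vertex. A zigzag is periodic and is regarded as a cyclic sequence $e_1,\dots,e_n$ with $n$ minimal; the reversed sequence $Z^{ -1}$ is also a zigzag and $Z\neq Z^{ -1}$. A zigzag traverses each of its edges $e_i$ in a direction: from the common vertex of $e_{i-1},e_i$ to the common vertex of $e_i,e_{i+1}$. If $\Gamma$ has exactly $k$ zigzags up to reversal, a $z$-orientation $\tau$ is a set of $k$ zigzags containing exactly one of $Z,Z^{ -1}$ for each zigzag $Z$. Each edge $e$ then occurs exactly twice in total among the zigzags of $\tau$ (twice in one zigzag and in no other, or once in each of two distinct zigzags and in no other); $e$ is of type I if these two occurrences traverse $e$ in opposite directions and of type II if in the same direction; an edge of type II is given that common direction. -}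

module Defs where

open import Data.Nat using (ℕ)
open import Data.Fin using (Fin)
open import Data.Fin.Subset using (Subset; _∈_; _⊆_; _∩_; _∪_; ⁅_⁆; ∣_∣)
open import Data.Integer using (ℤ; 0ℤ; _+_; -_; suc; pred)
open import Data.Product using (Σ; ∃; ∃-syntax; _×_; _,_)
open import Data.Sum using (_⊎_)
open import Relation.Nullary using (¬_)
open import Relation.Binary.PropositionalEquality using (_≡_; _≢_)
open import Relation.Binary.Construct.Closure.ReflexiveTransitive using (Star)

-- Vertices are Fin n; faces and edges are vertex subsets (the graph is
-- simple, and two distinct faces meet in an edge, a vertex or not at all,
-- so faces are determined by their vertex sets).

record Triangulation (n : ℕ) : Set₁ where
  field
    Face : Subset n → Set
    face-card : ∀ F → Face F → ∣ F ∣ ≡ 3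
    vertex-on-face : ∀ (v : Fin n) → ∃[ F ] (Face F × v ∈ F)

  IsEdge : Subset n → Set
  IsEdge e = ∣ e ∣ ≡ 2 × ∃[ F ] (Face F × e ⊆ F)

  Adj : Fin n → Fin n → Set
  Adj u v = u ≢ v × IsEdge (⁅ u ⁆ ∪ ⁅ v ⁆)

  LinkAdj : Fin n → Subset n → Subset n → Set
  LinkAdj v F G = F ≢ G × Face F × Face G ×
    ∃[ e ] (IsEdge e × v ∈ e × e ⊆ F × e ⊆ G)

  field
    edge-two-faces : ∀ e → IsEdge e →
      ∃[ F₁ ] ∃[ F₂ ] (F₁ ≢ F₂ × Face F₁ × Face F₂ × e ⊆ F₁ × e ⊆ F₂ ×
        (∀ G → Face G → e ⊆ G → G ≡ F₁ ⊎ G ≡ F₂))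
    -- closed surface: the link of every vertex is a single cycle, i.e. the
    -- faces around v are connected through edges containing v
    link-connected : ∀ v F G → Face F → Face G → v ∈ F → v ∈ G →
      Star (LinkAdj v) F G
    connected : ∀ u v → Star Adj u v

module _ {n : ℕ} (Γ : Triangulation n) where
  open Triangulation Γ

  -- Zigzags, as bi-infinite sequences of edges (a periodic sequence indexed
  -- by ℕ extends uniquely to ℤ).  The face containing e i and e (suc i) is
  -- their union.

  IsZigzag : (ℤ → Subset n) → Set
  IsZigzag z = ∀ i →
    IsEdge (z i) ×
    z i ≢ z (suc i) ×
    Face (z i ∪ z (suc i)) ×
    (z i ∪ z (suc i)) ≢ (z (suc i) ∪ z (suc (suc i))) ×
    (∀ v → ¬ (v ∈ z i × v ∈ z (suc (suc i))))


  shift : ℤ → (ℤ → Subset n) → (ℤ → Subset n)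
  shift k z i = z (i + k)

  rev : (ℤ → Subset n) → (ℤ → Subset n)
  rev z i = z (- i)

  -- z traverses its edge z i from a to b: a is the common vertex of
  -- z (i-1), z i and b is the common vertex of z i, z (i+1)
  Traverses : (ℤ → Subset n) → ℤ → Fin n → Fin n → Set
  Traverses z i a b = a ∈ z (pred i) × a ∈ z i × b ∈ z i × b ∈ z (suc i)

  -- z-orientations: a set of zigzags (each regarded as a cyclic sequence,
  -- i.e. up to shift) containing exactly one of Z, Z⁻¹ for every zigzag Z.

  record ZOrientation : Set₁ where
    field
      τ : (ℤ → Subset n) → Set
      τ-zigzag : ∀ z → τ z → IsZigzag z
      τ-cyclic : ∀ z z' k → τ z → (∀ i → z' i ≡ shift k z i) → τ z'
      τ-choice : ∀ z → IsZigzag z → (τ z × ¬ τ (rev z)) ⊎ (¬ τ z × τ (rev z))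

    -- An occurrence of an edge in τ is a zigzag of τ shifted so that the
    -- occurrence is at position 0; two occurrences are the same iff these
    -- sequences coincide.

    TypeI : Fin n → Fin n → Set
    TypeI a b = ∃[ z ] ∃[ z' ] (τ z × τ z' ×
      z 0ℤ ≡ ⁅ a ⁆ ∪ ⁅ b ⁆ × z' 0ℤ ≡ ⁅ a ⁆ ∪ ⁅ b ⁆ ×
      Traverses z 0ℤ a b × Traverses z' 0ℤ b a)

    TypeIIDir : Fin n → Fin n → Set
    TypeIIDir a b = ∃[ z ] ∃[ z' ] (τ z × τ z' ×
      z 0ℤ ≡ ⁅ a ⁆ ∪ ⁅ b ⁆ × z' 0ℤ ≡ ⁅ a ⁆ ∪ ⁅ b ⁆ ×
      ¬ (∀ i → z i ≡ z' i) ×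
      Traverses z 0ℤ a b × Traverses z' 0ℤ a b)

    TypeII : Fin n → Fin n → Set
    TypeII a b = TypeIIDir a b ⊎ TypeIIDir b a

    IsTriangle : Subset n → Fin n → Fin n → Fin n → Set
    IsTriangle F a b c = a ≢ b × b ≢ c × c ≢ a × F ≡ ⁅ a ⁆ ∪ ⁅ b ⁆ ∪ ⁅ c ⁆

    FaceCaseI : Subset n → Set
    FaceCaseI F = ∃[ a ] ∃[ b ] ∃[ c ] (IsTriangle F a b c ×
      TypeI a b × TypeI b c × TypeII c a)

    FaceCaseII : Subset n → Set
    FaceCaseII F = ∃[ a ] ∃[ b ] ∃[ c ] (IsTriangle F a b c ×
      TypeIIDir a b × TypeIIDir b c × TypeIIDir c a)

-- The edges ab and bc of a face F = {a, b, c} are consecutive edges of a zigzag that is unique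
-- up to reversal, since a zigzag is determined by two consecutive edges; τ contains exactly one
-- of its two directions, so every corner of F is turned either a → b → c or c → b → a. Each
-- edge of F is traversed once by the zigzag of each of its two corners, and τ has no other
-- occurrence of it: among any three zigzags traversing an edge away from the same endpoint, two
-- enter the same face, one of only two faces at the edge, and therefore coincide. So an edge is
-- of type II exactly when its two corners turn the same way. If all three corners agree, the
-- edges form a directed cycle (II); otherwise exactly two of them agree, which gives one edge of
-- type II and two of type I.

module Submission where

open import Defs
open import Data.Bool using (true; false)
open import Data.Empty using (⊥-elim)
open import Data.Fin using (Fin; zero; suc)
open import Data.Fin.Properties using (_≟_) renaming (suc-injective to Fin-suc-injective)
open import Data.Fin.Subset using (Subset; _∈_; _∉_; _⊆_; _∪_; ⁅_⁆; ∣_∣; ⊥)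
open import Data.Fin.Subset.Properties
  using (∣⁅x⁆∣≡1; x∈⁅x⁆; x∈⁅y⁆⇒x≡y; ⊆-antisym; p⊆p∪q; q⊆p∪q; x∈p∪q⁻; x∈p∪q⁺;
         ∪-identityˡ; ∪-identityʳ; ∪-comm)
open import Data.Integer using (ℤ; +_; -[1+_]; 0ℤ; 1ℤ; -1ℤ; -_) renaming (suc to sucℤ)
open import Data.Integer.Properties using (neg-distrib-+; suc-pred; +-identityʳ)
open import Data.Nat using (ℕ; zero; suc; _+_)
open import Data.Nat.GeneralisedArithmetic using (fold)
open import Data.Nat.Properties using (suc-injective)
open import Data.Product using (∃; ∃₂; ∃-syntax; _×_; _,_; proj₁; proj₂)
open import Data.Sum using (_⊎_; inj₁; inj₂)
open import Data.Vec using (_∷_; [])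
open import Function using (_∘_)
open import Relation.Nullary using (¬_; yes; no; Dec)
open import Relation.Nullary.Decidable using (_⊎-dec_)
open import Relation.Binary.PropositionalEquality
  using (_≡_; _≢_; _≗_; refl; sym; trans; cong; cong₂; subst; subst₂; ≢-sym)

private variable
  n : ℕ
  a b c p q s u v w : Fin n
  P : Subset n

pair : Fin n → Fin n → Subset n
pair a b = ⁅ a ⁆ ∪ ⁅ b ⁆

triple : Fin n → Fin n → Fin n → Subset n
triple a b c = ⁅ a ⁆ ∪ ⁅ b ⁆ ∪ ⁅ c ⁆

OneOf₂ : Fin n → Fin n → Fin n → Set
OneOf₂ v a b = v ≡ a ⊎ v ≡ b

OneOf₃ : Fin n → Fin n → Fin n → Fin n → Set
OneOf₃ v a b c = v ≡ a ⊎ OneOf₂ v b c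

oneOf₂? : ∀ (v a b : Fin n) → Dec (OneOf₂ v a b)
oneOf₂? v a b = (v ≟ a) ⊎-dec (v ≟ b)

Distinct : Fin n → Fin n → Fin n → Set
Distinct a b c = a ≢ b × b ≢ c × c ≢ a

Distinct-rotate : Distinct a b c → Distinct b c a
Distinct-rotate (a≢b , b≢c , c≢a) = b≢c , c≢a , a≢b

∈pair⁺ : OneOf₂ v a b → v ∈ pair a b
∈pair⁺ (inj₁ refl) = x∈p∪q⁺ (inj₁ (x∈⁅x⁆ _))
∈pair⁺ {a = a} (inj₂ refl) = x∈p∪q⁺ {p = ⁅ a ⁆} (inj₂ (x∈⁅x⁆ _))

∈pair⁻ : v ∈ pair a b → OneOf₂ v a b
∈pair⁻ {a = a} {b = b} v∈ with x∈p∪q⁻ ⁅ a ⁆ ⁅ b ⁆ v∈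
... | inj₁ v∈a = inj₁ (x∈⁅y⁆⇒x≡y a v∈a)
... | inj₂ v∈b = inj₂ (x∈⁅y⁆⇒x≡y b v∈b)

∈triple⁺ : OneOf₃ v a b c → v ∈ triple a b c
∈triple⁺ (inj₁ refl) = x∈p∪q⁺ (inj₁ (x∈⁅x⁆ _))
∈triple⁺ {a = a} (inj₂ v∈bc) = x∈p∪q⁺ {p = ⁅ a ⁆} (inj₂ (∈pair⁺ v∈bc))

∈triple⁻ : v ∈ triple a b c → OneOf₃ v a b c
∈triple⁻ {a = a} {b = b} {c = c} v∈ with x∈p∪q⁻ ⁅ a ⁆ (pair b c) v∈
... | inj₁ v∈a = inj₁ (x∈⁅y⁆⇒x≡y a v∈a)
... | inj₂ v∈bc = inj₂ (∈pair⁻ v∈bc)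

∈triple∧≢⇒∈pair : v ∈ triple a b c → v ≢ c → v ∈ pair a b
∈triple∧≢⇒∈pair v∈ v≢c with ∈triple⁻ v∈
... | inj₁ v≡a = ∈pair⁺ (inj₁ v≡a)
... | inj₂ (inj₁ v≡b) = ∈pair⁺ (inj₂ v≡b)
... | inj₂ (inj₂ v≡c) = ⊥-elim (v≢c v≡c)

triple⊆ : a ∈ P → b ∈ P → c ∈ P → triple a b c ⊆ P
triple⊆ a∈ b∈ c∈ v∈ with ∈triple⁻ v∈
... | inj₁ refl = a∈
... | inj₂ (inj₁ refl) = b∈
... | inj₂ (inj₂ refl) = c∈

pair⊆triple : pair a b ⊆ triple a b c
pair⊆triple v∈ with ∈pair⁻ v∈
... | inj₁ v≡a = ∈triple⁺ (inj₁ v≡a)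
... | inj₂ v≡b = ∈triple⁺ (inj₂ (inj₁ v≡b))

pair-comm : pair a b ≡ pair b a
pair-comm = ∪-comm _ _

pair∪pair : pair a b ∪ pair b c ≡ triple a b c
pair∪pair {a = a} {b = b} {c = c} =
  ⊆-antisym ⊆abc (triple⊆ (in-ab (inj₁ refl)) (in-ab (inj₂ refl)) (in-bc (inj₂ refl)))
  where
  in-ab : OneOf₂ v a b → v ∈ pair a b ∪ pair b c
  in-ab v∈ = p⊆p∪q (pair b c) (∈pair⁺ v∈)
  in-bc : OneOf₂ v b c → v ∈ pair a b ∪ pair b c
  in-bc v∈ = q⊆p∪q (pair a b) (pair b c) (∈pair⁺ v∈)
  ⊆abc : pair a b ∪ pair b c ⊆ triple a b c
  ⊆abc v∈ with x∈p∪q⁻ (pair a b) (pair b c) v∈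
  ... | inj₁ v∈ab = pair⊆triple v∈ab
  ... | inj₂ v∈bc = ∈triple⁺ (inj₂ (∈pair⁻ v∈bc))

triple-≡ : {a′ b′ c′ : Fin n} →
  (∀ {v} → OneOf₃ v a b c → OneOf₃ v a′ b′ c′) →
  (∀ {v} → OneOf₃ v a′ b′ c′ → OneOf₃ v a b c) →
  triple a b c ≡ triple a′ b′ c′
triple-≡ to from = ⊆-antisym (∈triple⁺ ∘ to ∘ ∈triple⁻) (∈triple⁺ ∘ from ∘ ∈triple⁻)

OneOf₃-rotate : OneOf₃ v a b c → OneOf₃ v b c a
OneOf₃-rotate (inj₁ v≡a) = inj₂ (inj₂ v≡a)
OneOf₃-rotate (inj₂ (inj₁ v≡b)) = inj₁ v≡b
OneOf₃-rotate (inj₂ (inj₂ v≡c)) = inj₂ (inj₁ v≡c)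

OneOf₃-swap : OneOf₃ v a b c → OneOf₃ v a c b
OneOf₃-swap (inj₁ v≡a) = inj₁ v≡a
OneOf₃-swap (inj₂ (inj₁ v≡b)) = inj₂ (inj₂ v≡b)
OneOf₃-swap (inj₂ (inj₂ v≡c)) = inj₂ (inj₁ v≡c)

triple-rotate : triple a b c ≡ triple b c a
triple-rotate = triple-≡ OneOf₃-rotate (OneOf₃-rotate ∘ OneOf₃-rotate)

triple-swap : triple a b c ≡ triple a c b
triple-swap = triple-≡ OneOf₃-swap OneOf₃-swap

pigeonhole₂ : OneOf₂ u a b → OneOf₂ v a b → OneOf₂ w a b → ¬ Distinct u v w
pigeonhole₂ (inj₁ refl) (inj₁ refl) _ (u≢v , _) = u≢v refl
pigeonhole₂ (inj₂ refl) (inj₂ refl) _ (u≢v , _) = u≢v refl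
pigeonhole₂ (inj₁ refl) (inj₂ refl) (inj₁ refl) (_ , _ , w≢u) = w≢u refl
pigeonhole₂ (inj₁ refl) (inj₂ refl) (inj₂ refl) (_ , v≢w , _) = v≢w refl
pigeonhole₂ (inj₂ refl) (inj₁ refl) (inj₁ refl) (_ , v≢w , _) = v≢w refl
pigeonhole₂ (inj₂ refl) (inj₁ refl) (inj₂ refl) (_ , _ , w≢u) = w≢u refl

distinct-covers : Distinct u v w → OneOf₃ u a b c → OneOf₃ v a b c → OneOf₃ w a b c → OneOf₃ a u v w
distinct-covers {u = u} {v = v} {w = w} {a = a} uvw u∈ v∈ w∈ with a ≟ u | a ≟ v | a ≟ w
... | yes a≡u | _ | _ = inj₁ a≡u
... | no _ | yes a≡v | _ = inj₂ (inj₁ a≡v)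
... | no _ | no _ | yes a≡w = inj₂ (inj₂ a≡w)
... | no a≢u | no a≢v | no a≢w =
  ⊥-elim (pigeonhole₂ (other a≢u u∈) (other a≢v v∈) (other a≢w w∈) uvw)
  where
  other : a ≢ s → OneOf₃ s a b c → OneOf₂ s b c
  other a≢s (inj₁ s≡a) = ⊥-elim (a≢s (sym s≡a))
  other _ (inj₂ s∈bc) = s∈bc

distinct-triple-≡ : Distinct u v w → triple u v w ⊆ triple a b c → triple u v w ≡ triple a b c
distinct-triple-≡ {u = u} {v = v} {w = w} {a = a} {b = b} {c = c} uvw uvw⊆abc =
  ⊆-antisym uvw⊆abc (λ s∈ → ∈triple⁺ (covered (∈triple⁻ s∈)))
  where
  u∈ : OneOf₃ u a b c
  u∈ = ∈triple⁻ (uvw⊆abc (∈triple⁺ (inj₁ refl)))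
  v∈ : OneOf₃ v a b c
  v∈ = ∈triple⁻ (uvw⊆abc (∈triple⁺ (inj₂ (inj₁ refl))))
  w∈ : OneOf₃ w a b c
  w∈ = ∈triple⁻ (uvw⊆abc (∈triple⁺ (inj₂ (inj₂ refl))))
  covered : OneOf₃ s a b c → OneOf₃ s u v w
  covered (inj₁ refl) = distinct-covers uvw u∈ v∈ w∈
  covered (inj₂ (inj₁ refl)) =
    distinct-covers uvw (OneOf₃-rotate u∈) (OneOf₃-rotate v∈) (OneOf₃-rotate w∈)
  covered (inj₂ (inj₂ refl)) =
    distinct-covers uvw (OneOf₃-rotate (OneOf₃-rotate u∈)) (OneOf₃-rotate (OneOf₃-rotate v∈))
      (OneOf₃-rotate (OneOf₃-rotate w∈))

third-vertex : Distinct a b c → ∀ p q → ∃[ w ] (OneOf₃ w a b c × ¬ OneOf₂ w p q)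
third-vertex {a = a} {b = b} {c = c} abc p q with oneOf₂? a p q | oneOf₂? b p q | oneOf₂? c p q
... | no a∉ | _ | _ = a , inj₁ refl , a∉
... | yes _ | no b∉ | _ = b , inj₂ (inj₁ refl) , b∉
... | yes _ | yes _ | no c∉ = c , inj₂ (inj₂ refl) , c∉
... | yes a∈ | yes b∈ | yes c∈ = ⊥-elim (pigeonhole₂ a∈ b∈ c∈ abc)

triple-through-pair : Distinct a b c → p ≢ q → pair p q ⊆ triple a b c →
  ∃[ w ] (Distinct p q w × triple a b c ≡ triple p q w)
triple-through-pair {a = a} {b = b} {c = c} {p = p} {q = q} abc p≢q pq⊆abc with third-vertex abc p q
... | w , w∈ , w∉ =
  w , pqw , sym (distinct-triple-≡ pqw (triple⊆ p∈abc q∈abc (∈triple⁺ w∈)))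
  where
  pqw : Distinct p q w
  pqw = p≢q , (λ q≡w → w∉ (inj₂ (sym q≡w))) , (λ w≡p → w∉ (inj₁ w≡p))
  p∈abc : p ∈ triple a b c
  p∈abc = pq⊆abc (∈pair⁺ (inj₁ refl))
  q∈abc : q ∈ triple a b c
  q∈abc = pq⊆abc (∈pair⁺ (inj₂ refl))

∣pair∣≡2 : a ≢ b → ∣ pair a b ∣ ≡ 2
∣pair∣≡2 {a = zero} {b = zero} a≢b = ⊥-elim (a≢b refl)
∣pair∣≡2 {a = zero} {b = suc b} _ rewrite ∪-identityˡ ⁅ b ⁆ = cong suc (∣⁅x⁆∣≡1 b)
∣pair∣≡2 {a = suc a} {b = zero} _ rewrite ∪-identityʳ ⁅ a ⁆ = cong suc (∣⁅x⁆∣≡1 a)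
∣pair∣≡2 {a = suc a} {b = suc b} a≢b = ∣pair∣≡2 (a≢b ∘ cong suc)

∣p∣≡0⇒p≡⊥ : ∣ P ∣ ≡ 0 → P ≡ ⊥
∣p∣≡0⇒p≡⊥ {P = []} _ = refl
∣p∣≡0⇒p≡⊥ {P = false ∷ P} ∣P∣≡0 = cong (false ∷_) (∣p∣≡0⇒p≡⊥ ∣P∣≡0)

∣p∣≡1⇒p≡⁅x⁆ : ∣ P ∣ ≡ 1 → ∃[ a ] P ≡ ⁅ a ⁆
∣p∣≡1⇒p≡⁅x⁆ {P = true ∷ P} ∣P∣≡1 =
  zero , cong (true ∷_) (∣p∣≡0⇒p≡⊥ (suc-injective ∣P∣≡1))
∣p∣≡1⇒p≡⁅x⁆ {P = false ∷ P} ∣P∣≡1 with ∣p∣≡1⇒p≡⁅x⁆ ∣P∣≡1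
... | a , P≡a = suc a , cong (false ∷_) P≡a

∣p∣≡2⇒p≡pair : ∣ P ∣ ≡ 2 → ∃₂ λ a b → a ≢ b × P ≡ pair a b
∣p∣≡2⇒p≡pair {P = true ∷ P} ∣P∣≡2 with ∣p∣≡1⇒p≡⁅x⁆ (suc-injective ∣P∣≡2)
... | b , P≡b = zero , suc b , (λ ()) , cong (true ∷_) (trans P≡b (sym (∪-identityˡ _)))
∣p∣≡2⇒p≡pair {P = false ∷ P} ∣P∣≡2 with ∣p∣≡2⇒p≡pair ∣P∣≡2
... | a , b , a≢b , P≡ab = suc a , suc b , a≢b ∘ Fin-suc-injective , cong (false ∷_) P≡ab

∣p∣≡3⇒p≡triple : ∣ P ∣ ≡ 3 → ∃[ a ] ∃[ b ] ∃[ c ] (Distinct a b c × P ≡ triple a b c)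
∣p∣≡3⇒p≡triple {P = true ∷ P} ∣P∣≡3 with ∣p∣≡2⇒p≡pair (suc-injective ∣P∣≡3)
... | b , c , b≢c , P≡bc =
  zero , suc b , suc c , ((λ ()) , b≢c ∘ Fin-suc-injective , (λ ())) ,
  cong (true ∷_) (trans P≡bc (sym (∪-identityˡ _)))
∣p∣≡3⇒p≡triple {P = false ∷ P} ∣P∣≡3 with ∣p∣≡3⇒p≡triple ∣P∣≡3
... | a , b , c , (a≢b , b≢c , c≢a) , P≡abc =
  suc a , suc b , suc c , (a≢b ∘ Fin-suc-injective , b≢c ∘ Fin-suc-injective , c≢a ∘ Fin-suc-injective) ,
  cong (false ∷_) P≡abc

module _ {n : ℕ} (Γ : Triangulation n) where
  open Triangulation Γ

  face-triple : ∀ {F} → Face F → ∃[ a ] ∃[ b ] ∃[ c ] (Distinct a b c × F ≡ triple a b c)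
  face-triple {F} F-face = ∣p∣≡3⇒p≡triple (face-card F F-face)

  edge-pair : ∀ {e} → IsEdge e → ∃₂ λ a b → a ≢ b × e ≡ pair a b
  edge-pair (∣e∣≡2 , _) = ∣p∣≡2⇒p≡pair ∣e∣≡2

  face-≡-triple : ∀ {F a b c} → Face F → Distinct a b c → triple a b c ⊆ F → F ≡ triple a b c
  face-≡-triple F-face abc abc⊆F with face-triple F-face
  ... | _ , _ , _ , _ , refl = sym (distinct-triple-≡ abc abc⊆F)

  faces-through-edge-collide : ∀ {e F G H} → IsEdge e → Face F → Face G → Face H →
    e ⊆ F → e ⊆ G → e ⊆ H → F ≡ G ⊎ G ≡ H ⊎ F ≡ H
  faces-through-edge-collide {e} {F} {G} {H} e-edge F-face G-face H-face e⊆F e⊆G e⊆H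
    with edge-two-faces e e-edge
  ... | _ , _ , _ , _ , _ , _ , _ , only with only F F-face e⊆F | only G G-face e⊆G | only H H-face e⊆H
  ... | inj₁ F≡ | inj₁ G≡ | _      = inj₁ (trans F≡ (sym G≡))
  ... | inj₂ F≡ | inj₂ G≡ | _      = inj₁ (trans F≡ (sym G≡))
  ... | inj₁ F≡ | inj₂ _  | inj₁ H≡ = inj₂ (inj₂ (trans F≡ (sym H≡)))
  ... | inj₁ _  | inj₂ G≡ | inj₂ H≡ = inj₂ (inj₁ (trans G≡ (sym H≡)))
  ... | inj₂ _  | inj₁ G≡ | inj₁ H≡ = inj₂ (inj₁ (trans G≡ (sym H≡)))
  ... | inj₂ F≡ | inj₁ _  | inj₂ H≡ = inj₂ (inj₂ (trans F≡ (sym H≡)))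

  other-face-unique : ∀ {e F G H} → IsEdge e → Face F → Face G → Face H →
    e ⊆ F → e ⊆ G → e ⊆ H → G ≢ F → H ≢ F → G ≡ H
  other-face-unique e-edge F-face G-face H-face e⊆F e⊆G e⊆H G≢F H≢F
    with faces-through-edge-collide e-edge F-face G-face H-face e⊆F e⊆G e⊆H
  ... | inj₁ F≡G        = ⊥-elim (G≢F (sym F≡G))
  ... | inj₂ (inj₁ G≡H) = G≡H
  ... | inj₂ (inj₂ F≡H) = ⊥-elim (H≢F (sym F≡H))

  ⊆-opposite-edge : ∀ {F v e e′} → Face F → v ∈ F →
    IsEdge e → e ⊆ F → v ∉ e → e′ ⊆ F → v ∉ e′ → e′ ⊆ e
  ⊆-opposite-edge {F} {v} F-face v∈F e-edge e⊆F v∉e e′⊆F v∉e′ {s} s∈e′ with edge-pair e-edge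
  ... | a , b , a≢b , refl =
    ∈triple∧≢⇒∈pair (subst (s ∈_) F≡abv (e′⊆F s∈e′)) (λ { refl → v∉e′ s∈e′ })
    where
    a∈e : a ∈ pair a b
    a∈e = ∈pair⁺ (inj₁ refl)
    b∈e : b ∈ pair a b
    b∈e = ∈pair⁺ (inj₂ refl)
    F≡abv : F ≡ triple a b v
    F≡abv = face-≡-triple F-face (a≢b , (λ { refl → v∉e b∈e }) , (λ { refl → v∉e a∈e }))
      (triple⊆ (e⊆F a∈e) (e⊆F b∈e) v∈F)

  opposite-edge-unique : ∀ {F v e e′} → Face F → v ∈ F →
    IsEdge e → e ⊆ F → v ∉ e → IsEdge e′ → e′ ⊆ F → v ∉ e′ → e ≡ e′
  opposite-edge-unique F-face v∈F e-edge e⊆F v∉e e′-edge e′⊆F v∉e′ =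
    ⊆-antisym (⊆-opposite-edge F-face v∈F e′-edge e′⊆F v∉e′ e⊆F v∉e)
              (⊆-opposite-edge F-face v∈F e-edge e⊆F v∉e e′⊆F v∉e′)

  common-vertex : ∀ {e e′} → IsEdge e → IsEdge e′ → Face (e ∪ e′) → ∃[ v ] (v ∈ e × v ∈ e′)
  common-vertex e-edge e′-edge e∪e′-face with edge-pair e-edge | edge-pair e′-edge
  ... | a , b , a≢b , refl | c , d , c≢d , refl with oneOf₂? c a b
  ... | yes c∈ab = c , ∈pair⁺ c∈ab , ∈pair⁺ (inj₁ refl)
  ... | no c∉ab =
    d , ∈triple∧≢⇒∈pair (subst (d ∈_) ab∪cd≡abc d∈ab∪cd) (≢-sym c≢d) , ∈pair⁺ (inj₂ refl)
    where
    d∈ab∪cd : d ∈ pair a b ∪ pair c d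
    d∈ab∪cd = q⊆p∪q (pair a b) (pair c d) (∈pair⁺ (inj₂ refl))
    ab∪cd≡abc : pair a b ∪ pair c d ≡ triple a b c
    ab∪cd≡abc = face-≡-triple e∪e′-face
      (a≢b , (λ { refl → c∉ab (inj₂ refl) }) , (λ { refl → c∉ab (inj₁ refl) }))
      (triple⊆ (p⊆p∪q (pair c d) (∈pair⁺ (inj₁ refl))) (p⊆p∪q (pair c d) (∈pair⁺ (inj₂ refl)))
               (q⊆p∪q (pair a b) (pair c d) (∈pair⁺ (inj₁ refl))))

  face-through-pair : ∀ {G p q} → Face G → p ≢ q → pair p q ⊆ G →
    ∃[ w ] (Distinct p q w × G ≡ triple p q w)
  face-through-pair G-face p≢q pq⊆G with face-triple G-face
  ... | _ , _ , _ , abc , refl = triple-through-pair abc p≢q pq⊆G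

  face-across : ∀ {e F} → IsEdge e → Face F → e ⊆ F → ∃[ G ] (Face G × e ⊆ G × F ≢ G)
  face-across {e} {F} e-edge F-face e⊆F with edge-two-faces e e-edge
  ... | F₁ , F₂ , F₁≢F₂ , F₁-face , F₂-face , e⊆F₁ , e⊆F₂ , only with only F F-face e⊆F
  ... | inj₁ refl = F₂ , F₂-face , e⊆F₂ , F₁≢F₂
  ... | inj₂ refl = F₁ , F₁-face , e⊆F₁ , λ F₂≡F₁ → F₁≢F₂ (sym F₂≡F₁)

  -- Opaque: only the existence of the apex matters, and letting Agda unfold this proof while
  -- checking `zigzag-vertex-adjacent` exhausts memory.
  opaque
    other-face : ∀ {p q r} → Distinct p q r → Face (triple p q r) →
      ∃[ w ] (Distinct p q w × Face (triple p q w) × triple p q r ≢ triple p q w)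
    other-face {p} {q} {r} (p≢q , _) pqr-face
      with face-across (∣pair∣≡2 p≢q , triple p q r , pqr-face , pair⊆triple) pqr-face pair⊆triple
    ... | G , G-face , pq⊆G , pqr≢G with face-through-pair G-face p≢q pq⊆G
    ... | w , pqw , refl = w , pqw , G-face , pqr≢G

  ZigzagStep : Subset n → Subset n → Subset n → Set
  ZigzagStep A B C = IsEdge A × A ≢ B × Face (A ∪ B) × A ∪ B ≢ B ∪ C × (∀ v → ¬ (v ∈ A × v ∈ C))

  zigzag-edge : ∀ {z} → IsZigzag Γ z → ∀ i → IsEdge (z i)
  zigzag-edge z-zigzag i = proj₁ (z-zigzag i)

  zigzag-face : ∀ {z} → IsZigzag Γ z → ∀ i → Face (z i ∪ z (sucℤ i))
  zigzag-face z-zigzag i = proj₁ (proj₂ (proj₂ (z-zigzag i)))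

  zigzag-turns : ∀ {z} → IsZigzag Γ z → ∀ i → z i ∪ z (sucℤ i) ≢ z (sucℤ i) ∪ z (sucℤ (sucℤ i))
  zigzag-turns z-zigzag i = proj₁ (proj₂ (proj₂ (proj₂ (z-zigzag i))))

  zigzag-disjoint : ∀ {z} → IsZigzag Γ z → ∀ i v → ¬ (v ∈ z i × v ∈ z (sucℤ (sucℤ i)))
  zigzag-disjoint z-zigzag i = proj₂ (proj₂ (proj₂ (proj₂ (z-zigzag i))))

  Consecutive : Subset n → Subset n → Subset n → Set
  Consecutive A B C = IsEdge A × IsEdge B × IsEdge C × A ≢ B × B ≢ C × Face (A ∪ B) × Face (B ∪ C) ×
    A ∪ B ≢ B ∪ C × (∀ v → ¬ (v ∈ A × v ∈ C))

  consecutive : ∀ {z} → IsZigzag Γ z → ∀ i → Consecutive (z i) (z (sucℤ i)) (z (sucℤ (sucℤ i)))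
  consecutive z-zigzag i with z-zigzag i | z-zigzag (sucℤ i) | z-zigzag (sucℤ (sucℤ i))
  ... | A-edge , A≢B , AB-face , AB≢BC , A-disjoint-C | B-edge , B≢C , BC-face , _ | C-edge , _ =
    A-edge , B-edge , C-edge , A≢B , B≢C , AB-face , BC-face , AB≢BC , A-disjoint-C

  Consecutive⇒ZigzagStep : ∀ {A B C} → Consecutive A B C → ZigzagStep A B C
  Consecutive⇒ZigzagStep (A-edge , _ , _ , A≢B , _ , AB-face , _ , AB≢BC , A-disjoint-C) =
    A-edge , A≢B , AB-face , AB≢BC , A-disjoint-C

  Consecutive-reverse : ∀ {A B C} → Consecutive A B C → Consecutive C B A
  Consecutive-reverse {A} {B} {C}
                      (A-edge , B-edge , C-edge , A≢B , B≢C , AB-face , BC-face , AB≢BC , A-disjoint-C) =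
    C-edge , B-edge , A-edge , ≢-sym B≢C , ≢-sym A≢B ,
    subst Face (∪-comm B C) BC-face , subst Face (∪-comm A B) AB-face ,
    (λ CB≡BA → AB≢BC (trans (∪-comm A B) (trans (sym CB≡BA) (∪-comm C B)))) ,
    (λ v (v∈C , v∈A) → A-disjoint-C v (v∈A , v∈C))

  next-edge-unique : ∀ {A B C C′} → Consecutive A B C → Consecutive A B C′ → C ≡ C′
  next-edge-unique {A} {B} {C} {C′} (A-edge , B-edge , C-edge , _ , _ , AB-face , BC-face , AB≢BC , A-disjoint-C)
                                     (_ , _ , C′-edge , _ , _ , _ , BC′-face , AB≢BC′ , A-disjoint-C′)
    with common-vertex A-edge B-edge AB-face
  ... | v , v∈A , v∈B = opposite-edge-unique BC-face (p⊆p∪q C v∈B)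
    C-edge (q⊆p∪q B C) (λ v∈C → A-disjoint-C v (v∈A , v∈C))
    C′-edge (subst (C′ ⊆_) (sym BC≡BC′) (q⊆p∪q B C′))
    (λ v∈C′ → A-disjoint-C′ v (v∈A , v∈C′))
    where
    BC≡BC′ : B ∪ C ≡ B ∪ C′
    BC≡BC′ = other-face-unique B-edge AB-face BC-face BC′-face (q⊆p∪q A B) (p⊆p∪q C) (p⊆p∪q C′)
      (≢-sym AB≢BC) (≢-sym AB≢BC′)

  previous-edge-unique : ∀ {A A′ B C} → Consecutive A B C → Consecutive A′ B C → A ≡ A′
  previous-edge-unique ABC A′BC = next-edge-unique (Consecutive-reverse ABC) (Consecutive-reverse A′BC)

  zigzag-determined : ∀ {w w′} → IsZigzag Γ w → IsZigzag Γ w′ →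
    w 0ℤ ≡ w′ 0ℤ → w 1ℤ ≡ w′ 1ℤ → w ≗ w′
  zigzag-determined {w} {w′} w-zigzag w′-zigzag w₀≡ w₁≡ i = proj₁ (agree i)
    where
    Agree : ℤ → Set
    Agree i = w i ≡ w′ i × w (sucℤ i) ≡ w′ (sucℤ i)
    forward : ∀ i → Agree i → Agree (sucℤ i)
    forward i (≡i , ≡i+1) = ≡i+1 ,
      next-edge-unique (consecutive w-zigzag i)
        (subst₂ (λ A B → Consecutive A B (w′ (sucℤ (sucℤ i)))) (sym ≡i) (sym ≡i+1)
                (consecutive w′-zigzag i))
    backward : ∀ i → Agree (sucℤ i) → Agree i
    backward i (≡i+1 , ≡i+2) =
      previous-edge-unique (consecutive w-zigzag i)
        (subst₂ (Consecutive (w′ i)) (sym ≡i+1) (sym ≡i+2) (consecutive w′-zigzag i)) ,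
      ≡i+1
    agree : ∀ i → Agree i
    agree (+ zero) = w₀≡ , w₁≡
    agree (+ suc k) = forward (+ k) (agree (+ k))
    agree -[1+ zero ] = backward -[1+ zero ] (agree 0ℤ)
    agree -[1+ suc k ] = backward -[1+ suc k ] (agree -[1+ k ])

  rev-zigzag : ∀ {z} → IsZigzag Γ z → IsZigzag Γ (rev Γ z)
  rev-zigzag {z} z-zigzag i = Consecutive⇒ZigzagStep (Consecutive-reverse
    (subst₂ (Consecutive (z (- sucℤ (sucℤ i)))) (cong z (suc-neg-suc (sucℤ i)))
      (cong z (trans (cong sucℤ (suc-neg-suc (sucℤ i))) (suc-neg-suc i)))
      (consecutive z-zigzag (- sucℤ (sucℤ i)))))
    where
    suc-neg-suc : ∀ j → sucℤ (- sucℤ j) ≡ - j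
    suc-neg-suc j = trans (cong sucℤ (neg-distrib-+ 1ℤ j)) (suc-pred (- j))

  AdjacentFaces : Fin n → Fin n → Fin n → Fin n → Set
  AdjacentFaces p q r s =
    Distinct p q r × Face (triple p q r) × Distinct q r s × Face (triple q r s) × triple p q r ≢ triple q r s

  AdjacentFaces⇒ZigzagStep : ∀ {p q r s} → AdjacentFaces p q r s →
    ZigzagStep (pair p q) (pair q r) (pair r s)
  AdjacentFaces⇒ZigzagStep {p} {q} {r} {s}
                           ((p≢q , q≢r , r≢p) , pqr-face , (_ , r≢s , s≢q) , _ , pqr≢qrs) =
    (∣pair∣≡2 p≢q , triple p q r , pqr-face , pair⊆triple) ,
    (λ pq≡qr → p∉qr (∈pair⁻ (subst (p ∈_) pq≡qr (∈pair⁺ (inj₁ refl))))) ,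
    subst Face (sym pair∪pair) pqr-face ,
    (λ pqr≡qrs → pqr≢qrs (trans (sym pair∪pair) (trans pqr≡qrs pair∪pair))) ,
    disjoint
    where
    p∉qr : ¬ OneOf₂ p q r
    p∉qr (inj₁ p≡q) = p≢q p≡q
    p∉qr (inj₂ p≡r) = r≢p (sym p≡r)
    disjoint : ∀ v → ¬ (v ∈ pair p q × v ∈ pair r s)
    disjoint v (v∈pq , v∈rs) with ∈pair⁻ v∈pq | ∈pair⁻ v∈rs
    ... | inj₁ refl | inj₁ refl = r≢p refl
    ... | inj₁ refl | inj₂ refl = pqr≢qrs triple-rotate
    ... | inj₂ refl | inj₁ refl = q≢r refl
    ... | inj₂ refl | inj₂ refl = s≢q refl

  record OrientedFace : Set where
    constructor oriented
    field
      x y z : Fin n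
      distinct : Distinct x y z
      face : Face (triple x y z)
  open OrientedFace

  step : OrientedFace → OrientedFace
  step t =
    let w , yzw , yzw-face , _ = other-face (Distinct-rotate (distinct t)) (subst Face triple-rotate (face t))
    in oriented (y t) (z t) w yzw yzw-face

  step-adjacent : ∀ t → AdjacentFaces (x t) (y t) (z t) (z (step t))
  step-adjacent t =
    let _ , yzw , yzw-face , yzx≢yzw = other-face (Distinct-rotate (distinct t)) (subst Face triple-rotate (face t))
    in distinct t , face t , yzw , yzw-face , λ xyz≡yzw → yzx≢yzw (trans (sym triple-rotate) xyz≡yzw)

  back : OrientedFace → OrientedFace
  back t =
    let w , xyw , xyw-face , _ = other-face (distinct t) (face t)
    in oriented w (x t) (y t) (Distinct-rotate (Distinct-rotate xyw))
                (subst Face (trans triple-rotate triple-rotate) xyw-face)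

  back-adjacent : ∀ t → AdjacentFaces (x (back t)) (x t) (y t) (z t)
  back-adjacent t =
    let _ , xyw , xyw-face , xyz≢xyw = other-face (distinct t) (face t)
    in Distinct-rotate (Distinct-rotate xyw) , subst Face (trans triple-rotate triple-rotate) xyw-face ,
       distinct t , face t , λ wxy≡xyz → xyz≢xyw (sym (trans (trans triple-rotate triple-rotate) wxy≡xyz))

  -- The zigzag through the corner y of the face xyz: each step appends the apex of the face
  -- across the last edge, in either direction.
  zigzag-vertex : OrientedFace → ℤ → Fin n
  zigzag-vertex t (+ k) = x (fold t step k)
  zigzag-vertex t -[1+ k ] = x (fold t back (suc k))

  zigzag-vertex-adjacent : ∀ t i → let v = zigzag-vertex t in
    AdjacentFaces (v i) (v (sucℤ i)) (v (sucℤ (sucℤ i))) (v (sucℤ (sucℤ (sucℤ i))))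
  zigzag-vertex-adjacent t (+ k) = step-adjacent (fold t step k)
  -- sucℤ only computes on -[1+ k ] for k of known shape, hence the unfolded clauses.
  zigzag-vertex-adjacent t -[1+ 0 ] = back-adjacent t
  zigzag-vertex-adjacent t -[1+ 1 ] = back-adjacent (back t)
  zigzag-vertex-adjacent t -[1+ 2 ] = back-adjacent (fold t back 2)
  zigzag-vertex-adjacent t -[1+ suc (suc (suc k)) ] = back-adjacent (fold t back (3 + k))

  zigzag-through : OrientedFace → ℤ → Subset n
  zigzag-through t i = pair (zigzag-vertex t i) (zigzag-vertex t (sucℤ i))

  zigzag-through-isZigzag : ∀ t → IsZigzag Γ (zigzag-through t)
  zigzag-through-isZigzag t i = AdjacentFaces⇒ZigzagStep (zigzag-vertex-adjacent t i)

  pairs-traverse : ∀ {w p a b q} → w -1ℤ ≡ pair p a → w 0ℤ ≡ pair a b → w 1ℤ ≡ pair b q →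
    Traverses Γ w 0ℤ a b
  pairs-traverse w₋₁≡ w₀≡ w₁≡ =
    subst (_ ∈_) (sym w₋₁≡) (∈pair⁺ (inj₂ refl)) ,
    subst (_ ∈_) (sym w₀≡) (∈pair⁺ (inj₁ refl)) ,
    subst (_ ∈_) (sym w₀≡) (∈pair⁺ (inj₂ refl)) ,
    subst (_ ∈_) (sym w₁≡) (∈pair⁺ (inj₁ refl))

  TraversesFrom : Fin n → Subset n → (ℤ → Subset n) → Set
  TraversesFrom a e w = IsZigzag Γ w × w 0ℤ ≡ e × a ∈ e × a ∉ w 1ℤ

  Traverses⇒TraversesFrom : ∀ {w e a b} → IsZigzag Γ w → w 0ℤ ≡ e → Traverses Γ w 0ℤ a b →
    TraversesFrom a e w
  Traverses⇒TraversesFrom w-zigzag refl (a∈w₋₁ , a∈w₀ , _) =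
    w-zigzag , refl , a∈w₀ , λ a∈w₁ → zigzag-disjoint w-zigzag -1ℤ _ (a∈w₋₁ , a∈w₁)

  Traverses⇒rev-TraversesFrom : ∀ {w e a b} → IsZigzag Γ w → w 0ℤ ≡ e → Traverses Γ w 0ℤ b a →
    TraversesFrom a e (rev Γ w)
  Traverses⇒rev-TraversesFrom w-zigzag refl (_ , _ , a∈w₀ , a∈w₁) =
    rev-zigzag w-zigzag , refl , a∈w₀ , λ a∈w₋₁ → zigzag-disjoint w-zigzag -1ℤ _ (a∈w₋₁ , a∈w₁)

  traversals-with-same-face-agree : ∀ {a e w w′} → TraversesFrom a e w → TraversesFrom a e w′ →
    w 0ℤ ∪ w 1ℤ ≡ w′ 0ℤ ∪ w′ 1ℤ → w ≗ w′
  traversals-with-same-face-agree {w = w} {w′}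
                                  (w-zigzag , refl , a∈w₀ , a∉w₁) (w′-zigzag , w′₀≡ , _ , a∉w′₁) F≡ =
    zigzag-determined w-zigzag w′-zigzag (sym w′₀≡)
      (opposite-edge-unique (zigzag-face w-zigzag 0ℤ) (p⊆p∪q (w 1ℤ) a∈w₀)
        (zigzag-edge w-zigzag 1ℤ) (q⊆p∪q (w 0ℤ) (w 1ℤ)) a∉w₁
        (zigzag-edge w′-zigzag 1ℤ) (subst (w′ 1ℤ ⊆_) (sym F≡) (q⊆p∪q (w′ 0ℤ) (w′ 1ℤ)))
        a∉w′₁)

  TraversesFrom⇒⊆-face : ∀ {a e w} → TraversesFrom a e w → e ⊆ w 0ℤ ∪ w 1ℤ
  TraversesFrom⇒⊆-face {w = w} (_ , refl , _) = p⊆p∪q (w 1ℤ)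

  at-most-two-traversals-from : ∀ {a e w₁ w₂ w₃} →
    TraversesFrom a e w₁ → TraversesFrom a e w₂ → TraversesFrom a e w₃ →
    w₁ ≗ w₂ ⊎ w₂ ≗ w₃ ⊎ w₁ ≗ w₃
  at-most-two-traversals-from t₁@(w₁-zigzag , refl , _) t₂@(w₂-zigzag , _) t₃@(w₃-zigzag , _)
    with faces-through-edge-collide (zigzag-edge w₁-zigzag 0ℤ)
           (zigzag-face w₁-zigzag 0ℤ) (zigzag-face w₂-zigzag 0ℤ) (zigzag-face w₃-zigzag 0ℤ)
           (TraversesFrom⇒⊆-face t₁) (TraversesFrom⇒⊆-face t₂) (TraversesFrom⇒⊆-face t₃)
  ... | inj₁ F₁≡F₂ = inj₁ (traversals-with-same-face-agree t₁ t₂ F₁≡F₂)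
  ... | inj₂ (inj₁ F₂≡F₃) = inj₂ (inj₁ (traversals-with-same-face-agree t₂ t₃ F₂≡F₃))
  ... | inj₂ (inj₂ F₁≡F₃) = inj₂ (inj₂ (traversals-with-same-face-agree t₁ t₃ F₁≡F₃))

  module _ (o : ZOrientation Γ) where
    open ZOrientation o

    τ-excludes-reversal : ∀ {w z} → τ w → τ z → ¬ w ≗ rev Γ z
    τ-excludes-reversal {w} {z} τw τz w≗rev-z with τ-choice z (τ-zigzag z τz)
    ... | inj₁ (_ , ¬τ-rev-z) =
      ¬τ-rev-z (τ-cyclic w (rev Γ z) 0ℤ τw λ i → trans (sym (w≗rev-z i)) (cong w (sym (+-identityʳ i))))
    ... | inj₂ (¬τz , _) = ¬τz τz

    TypeI⇒¬TypeIIDir : ∀ {a b} → TypeI a b → ¬ TypeIIDir a b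
    TypeI⇒¬TypeIIDir (_ , z , _ , τz , _ , z₀≡ab , _ , z-ba)
                     (y , y′ , τy , τy′ , y₀≡ab , y′₀≡ab , y≢y′ , y-ab , y′-ab)
      with at-most-two-traversals-from
             (Traverses⇒TraversesFrom (τ-zigzag y τy) y₀≡ab y-ab)
             (Traverses⇒TraversesFrom (τ-zigzag y′ τy′) y′₀≡ab y′-ab)
             (Traverses⇒rev-TraversesFrom (τ-zigzag z τz) z₀≡ab z-ba)
    ... | inj₁ y≗y′ = y≢y′ y≗y′
    ... | inj₂ (inj₁ y′≗rev-z) = τ-excludes-reversal τy′ τz y′≗rev-z
    ... | inj₂ (inj₂ y≗rev-z) = τ-excludes-reversal τy τz y≗rev-z

    IntoFace : Subset n → Fin n → Fin n → Set
    IntoFace F a b = ∃[ w ] (τ w × w 0ℤ ≡ pair a b × Traverses Γ w 0ℤ a b × w 0ℤ ∪ w 1ℤ ≡ F)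

    OutOfFace : Subset n → Fin n → Fin n → Set
    OutOfFace F a b = ∃[ w ] (τ w × w 0ℤ ≡ pair a b × Traverses Γ w 0ℤ a b × w -1ℤ ∪ w 0ℤ ≡ F)

    CornerOrientation : Subset n → Fin n → Fin n → Fin n → Set
    CornerOrientation F a b c = (IntoFace F a b × OutOfFace F b c) ⊎ (OutOfFace F b a × IntoFace F c b)

    oriented-corner : ∀ t → CornerOrientation (triple (x t) (y t) (z t)) (x t) (y t) (z t)
    oriented-corner t with τ-choice (zigzag-through t) (zigzag-through-isZigzag t)
    ... | inj₁ (τZ , _) =
      let Z = zigzag-through t in
      inj₁ ( (Z , τZ , refl , pairs-traverse {w = Z} refl refl refl , pair∪pair)
           , (shift Γ 1ℤ Z , τ-cyclic Z _ 1ℤ τZ (λ _ → refl) , refl ,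
              pairs-traverse {w = shift Γ 1ℤ Z} refl refl refl , pair∪pair) )
    ... | inj₂ (_ , τR) =
      let R = rev Γ (zigzag-through t) in
      inj₂ ( (R , τR , pair-comm , pairs-traverse {w = R} pair-comm pair-comm pair-comm ,
              trans (∪-comm _ _) pair∪pair)
           , (shift Γ -1ℤ R , τ-cyclic R _ -1ℤ τR (λ _ → refl) , pair-comm ,
              pairs-traverse {w = shift Γ -1ℤ R} pair-comm pair-comm pair-comm , trans (∪-comm _ _) pair∪pair) )

    corner-orientation : ∀ {F a b c} → IsTriangle F a b c → Face F → CornerOrientation F a b c
    corner-orientation {a = a} {b} {c} (a≢b , b≢c , c≢a , refl) F-face =
      oriented-corner (oriented a b c (a≢b , b≢c , c≢a) F-face)

    Into×OutOf⇒TypeIIDir : ∀ {F a b} → IntoFace F a b → OutOfFace F a b → TypeIIDir a b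
    Into×OutOf⇒TypeIIDir (w , τw , w₀≡ab , w-ab , w-into)
                         (w′ , τw′ , w′₀≡ab , w′-ab , w′-outof) =
      w , w′ , τw , τw′ , w₀≡ab , w′₀≡ab , w≢w′ , w-ab , w′-ab
      where
      w≢w′ : ¬ w ≗ w′
      w≢w′ w≗w′ = zigzag-turns (τ-zigzag w τw) -1ℤ
        (trans (cong₂ _∪_ (w≗w′ -1ℤ) (w≗w′ 0ℤ)) (trans w′-outof (sym w-into)))

    Into×Into⇒TypeI : ∀ {F G a b} → IntoFace F a b → IntoFace G b a → TypeI a b
    Into×Into⇒TypeI (w , τw , w₀≡ab , w-ab , _) (w′ , τw′ , w′₀≡ba , w′-ba , _) =
      w , w′ , τw , τw′ , w₀≡ab , trans w′₀≡ba pair-comm , w-ab , w′-ba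

    OutOf×OutOf⇒TypeI : ∀ {F G a b} → OutOfFace F a b → OutOfFace G b a → TypeI a b
    OutOf×OutOf⇒TypeI (w , τw , w₀≡ab , w-ab , _) (w′ , τw′ , w′₀≡ba , w′-ba , _) =
      w , w′ , τw , τw′ , w₀≡ab , trans w′₀≡ba pair-comm , w-ab , w′-ba

    TypeI-sym : ∀ {a b} → TypeI a b → TypeI b a
    TypeI-sym (w , w′ , τw , τw′ , w₀≡ab , w′₀≡ab , w-ab , w′-ba) =
      w′ , w , τw′ , τw , trans w′₀≡ab pair-comm , trans w₀≡ab pair-comm , w′-ba , w-ab

    TypeI⇒¬TypeII : ∀ {a b} → TypeI a b → ¬ TypeII a b
    TypeI⇒¬TypeII ab-I (inj₁ ab-II) = TypeI⇒¬TypeIIDir ab-I ab-II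
    TypeI⇒¬TypeII ab-I (inj₂ ba-II) = TypeI⇒¬TypeIIDir (TypeI-sym ab-I) ba-II

    IsTriangle-rotate : ∀ {F a b c} → IsTriangle F a b c → IsTriangle F b c a
    IsTriangle-rotate (a≢b , b≢c , c≢a , F≡abc) = b≢c , c≢a , a≢b , trans F≡abc triple-rotate

    IsTriangle-swap : ∀ {F a b c} → IsTriangle F a b c → IsTriangle F a c b
    IsTriangle-swap (a≢b , b≢c , c≢a , F≡abc) =
      ≢-sym c≢a , ≢-sym b≢c , ≢-sym a≢b , trans F≡abc triple-swap

    corners⇒FaceCase : ∀ {F a b c} → IsTriangle F a b c →
      CornerOrientation F c a b → CornerOrientation F a b c → CornerOrientation F b c a →
      FaceCaseI F ⊎ FaceCaseII F
    corners⇒FaceCase {a = a} {b} {c} abc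
      (inj₁ (into-ca , outof-ab)) (inj₁ (into-ab , outof-bc)) (inj₁ (into-bc , outof-ca)) =
      inj₂ (a , b , c , abc ,
            Into×OutOf⇒TypeIIDir into-ab outof-ab , Into×OutOf⇒TypeIIDir into-bc outof-bc ,
            Into×OutOf⇒TypeIIDir into-ca outof-ca)
    corners⇒FaceCase {a = a} {b} {c} abc
      (inj₂ (outof-ac , into-ba)) (inj₂ (outof-ba , into-cb)) (inj₂ (outof-cb , into-ac)) =
      inj₂ (a , c , b , IsTriangle-swap abc ,
            Into×OutOf⇒TypeIIDir into-ac outof-ac , Into×OutOf⇒TypeIIDir into-cb outof-cb ,
            Into×OutOf⇒TypeIIDir into-ba outof-ba)
    corners⇒FaceCase {a = a} {b} {c} abc
      (inj₁ (into-ca , outof-ab)) (inj₂ (outof-ba , into-cb)) (inj₂ (outof-cb , into-ac)) =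
      inj₁ (c , a , b , IsTriangle-rotate (IsTriangle-rotate abc) ,
            Into×Into⇒TypeI into-ca into-ac , OutOf×OutOf⇒TypeI outof-ab outof-ba ,
            inj₂ (Into×OutOf⇒TypeIIDir into-cb outof-cb))
    corners⇒FaceCase {a = a} {b} {c} abc
      (inj₂ (outof-ac , into-ba)) (inj₁ (into-ab , outof-bc)) (inj₁ (into-bc , outof-ca)) =
      inj₁ (c , a , b , IsTriangle-rotate (IsTriangle-rotate abc) ,
            OutOf×OutOf⇒TypeI outof-ca outof-ac , Into×Into⇒TypeI into-ab into-ba ,
            inj₁ (Into×OutOf⇒TypeIIDir into-bc outof-bc))
    corners⇒FaceCase {a = a} {b} {c} abc
      (inj₁ (into-ca , outof-ab)) (inj₂ (outof-ba , into-cb)) (inj₁ (into-bc , outof-ca)) =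
      inj₁ (a , b , c , abc ,
            OutOf×OutOf⇒TypeI outof-ab outof-ba , Into×Into⇒TypeI into-bc into-cb ,
            inj₁ (Into×OutOf⇒TypeIIDir into-ca outof-ca))
    corners⇒FaceCase {a = a} {b} {c} abc
      (inj₂ (outof-ac , into-ba)) (inj₁ (into-ab , outof-bc)) (inj₂ (outof-cb , into-ac)) =
      inj₁ (a , b , c , abc ,
            Into×Into⇒TypeI into-ab into-ba , OutOf×OutOf⇒TypeI outof-bc outof-cb ,
            inj₂ (Into×OutOf⇒TypeIIDir into-ac outof-ac))
    corners⇒FaceCase {a = a} {b} {c} abc
      (inj₁ (into-ca , outof-ab)) (inj₁ (into-ab , outof-bc)) (inj₂ (outof-cb , into-ac)) =
      inj₁ (b , c , a , IsTriangle-rotate abc ,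
            OutOf×OutOf⇒TypeI outof-bc outof-cb , Into×Into⇒TypeI into-ca into-ac ,
            inj₁ (Into×OutOf⇒TypeIIDir into-ab outof-ab))
    corners⇒FaceCase {a = a} {b} {c} abc
      (inj₂ (outof-ac , into-ba)) (inj₂ (outof-ba , into-cb)) (inj₁ (into-bc , outof-ca)) =
      inj₁ (b , c , a , IsTriangle-rotate abc ,
            Into×Into⇒TypeI into-bc into-cb , OutOf×OutOf⇒TypeI outof-ca outof-ac ,
            inj₂ (Into×OutOf⇒TypeIIDir into-ba outof-ba))

    face-case : ∀ F → Face F → FaceCaseI F ⊎ FaceCaseII F
    face-case F F-face with face-triple F-face
    ... | a , b , c , (a≢b , b≢c , c≢a) , F≡abc =
      corners⇒FaceCase abc
        (corner-orientation cab F-face) (corner-orientation abc F-face) (corner-orientation bca F-face)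
      where
      abc : IsTriangle F a b c
      abc = a≢b , b≢c , c≢a , F≡abc
      bca : IsTriangle F b c a
      bca = IsTriangle-rotate abc
      cab : IsTriangle F c a b
      cab = IsTriangle-rotate bca

    TypeI-not-on-cycle : ∀ {a b p q r} → TypeI a b → a ≢ b → OneOf₃ a p q r → OneOf₃ b p q r →
      ¬ (TypeIIDir p q × TypeIIDir q r × TypeIIDir r p)
    TypeI-not-on-cycle _ a≢b (inj₁ refl) (inj₁ refl) _ = a≢b refl
    TypeI-not-on-cycle ab-I _ (inj₁ refl) (inj₂ (inj₁ refl)) (pq , _ , _) = TypeI⇒¬TypeII ab-I (inj₁ pq)
    TypeI-not-on-cycle ab-I _ (inj₁ refl) (inj₂ (inj₂ refl)) (_ , _ , rp) = TypeI⇒¬TypeII ab-I (inj₂ rp)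
    TypeI-not-on-cycle ab-I _ (inj₂ (inj₁ refl)) (inj₁ refl) (pq , _ , _) = TypeI⇒¬TypeII ab-I (inj₂ pq)
    TypeI-not-on-cycle _ a≢b (inj₂ (inj₁ refl)) (inj₂ (inj₁ refl)) _ = a≢b refl
    TypeI-not-on-cycle ab-I _ (inj₂ (inj₁ refl)) (inj₂ (inj₂ refl)) (_ , qr , _) = TypeI⇒¬TypeII ab-I (inj₁ qr)
    TypeI-not-on-cycle ab-I _ (inj₂ (inj₂ refl)) (inj₁ refl) (_ , _ , rp) = TypeI⇒¬TypeII ab-I (inj₁ rp)
    TypeI-not-on-cycle ab-I _ (inj₂ (inj₂ refl)) (inj₂ (inj₁ refl)) (_ , qr , _) = TypeI⇒¬TypeII ab-I (inj₂ qr)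
    TypeI-not-on-cycle _ a≢b (inj₂ (inj₂ refl)) (inj₂ (inj₂ refl)) _ = a≢b refl

    FaceCaseI⇒¬FaceCaseII : ∀ {F} → FaceCaseI F → ¬ FaceCaseII F
    FaceCaseI⇒¬FaceCaseII (a , b , _ , (a≢b , _ , _ , refl) , ab-I , _)
                          (_ , _ , _ , (_ , _ , _ , F≡pqr) , pq , qr , rp) =
      TypeI-not-on-cycle ab-I a≢b (∈triple⁻ (subst (a ∈_) F≡pqr (∈triple⁺ (inj₁ refl))))
        (∈triple⁻ (subst (b ∈_) F≡pqr (∈triple⁺ (inj₂ (inj₁ refl))))) (pq , qr , rp)

proposition1 : ∀ {n} (Γ : Triangulation n) (o : ZOrientation Γ) →
    ∀ F → Triangulation.Face Γ F →
      (ZOrientation.FaceCaseI o F × ¬ ZOrientation.FaceCaseII o F) ⊎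
      (¬ ZOrientation.FaceCaseI o F × ZOrientation.FaceCaseII o F)
proposition1 Γ o F F-face with face-case Γ o F F-face
... | inj₁ caseI = inj₁ (caseI , FaceCaseI⇒¬FaceCaseII Γ o caseI)
... | inj₂ caseII = inj₂ ((λ caseI → FaceCaseI⇒¬FaceCaseII Γ o caseI caseII) , caseII)
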